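{- Let $G=(V,E)$ be a maximal outerplanar graph, and label its vertices $v_1,\dots,v_n$ in the order in which they appear along its Hamiltonian cycle (the boundary of the outer face). Let $c_1,c_2\in V$ be an optimal 2-center of $G$ with optimal radius $r$. Then $V$ can be partitioned into two cover sets $S_1,S_2$ such that $d(c_1,v)\le r$ for all $v\in S_1$, $d(c_2,v)\le r$ for all $v\in S_2$, and each of $S_1$ and $S_2$ is continuous, i.e. consists of vertices whose labels form a set of cyclically consecutive positions along the Hamiltonian cycle.
   Context: All graphs are finite, simple and connected. A maximal outerplanar graph is an outerplanar graph (one embeddable in the plane with all vertices on the outer face) to which no edge can be added while preserving outerplanarity; the boundary of its outer face is a Hamiltonian cycle. $d(u,v)$ denotes the shortest-path (number of edges) distance. A 2-center of $G$ is a pair of vertices $c_1,c_2$; its radius is $\max_{u\in V}\min_{i\in\{1,2\}} d(u,c_i)$, and it is optimal if this radius is minimum over all pairs of vertices. A cover set of a center $c$ (with radius $r$) is a set of vertices assigned to $c$, all at distance at most $r$ from $c$; every vertex is assigned to exactly one center. -}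

module Defs where

open import Data.Nat using (ℕ; zero; suc; _+_; _≤_; _<_; _%_; NonZero)
open import Data.Fin using (Fin; toℕ)
open import Data.Bool using (Bool; true; false)
open import Data.Product using (Σ; ∃; ∃-syntax; _×_; _,_)
open import Data.Sum using (_⊎_)
open import Relation.Nullary using (¬_)
open import Relation.Binary.PropositionalEquality using (_≡_; _≢_)

Adj : ℕ → Set₁
Adj n = Fin n → Fin n → Set

Between : ∀ {n} → Fin n → Fin n → Fin n → Set
Between u v x = (toℕ u < toℕ x × toℕ x < toℕ v) ⊎ (toℕ v < toℕ x × toℕ x < toℕ u)

Outside : ∀ {n} → Fin n → Fin n → Fin n → Set
Outside u v x = (toℕ x < toℕ u × toℕ x < toℕ v) ⊎ (toℕ u < toℕ x × toℕ v < toℕ x)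

-- The chords uv and xy cross when the vertices are placed on a circle
-- in label order (one of x, y strictly on each side of uv).
Cross : ∀ {n} → Fin n → Fin n → Fin n → Fin n → Set
Cross u v x y = (Between u v x × Outside u v y) ⊎ (Outside u v x × Between u v y)

CycleStep : ∀ {n} → Fin n → Fin n → Set
CycleStep {n} i j = suc (toℕ i) ≡ toℕ j ⊎ (suc (toℕ i) ≡ n × toℕ j ≡ 0 × 2 ≤ n)

-- G is a maximal outerplanar graph whose vertices are labelled 0,...,n-1
-- in the order of its outer-face Hamiltonian cycle: simple (symmetric,
-- irreflexive), the cycle edges are present, drawing the vertices on a
-- circle in label order gives no crossing edges (an outerplanar embedding
-- with that outer boundary), and no edge can be added (every non-edge
-- would cross an existing edge).
record MaximalOuterplanarLabelled {n : ℕ} (E : Adj n) : Set where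
  field
    nonempty    : 1 ≤ n
    symmetric   : ∀ u v → E u v → E v u
    irreflexive : ∀ u → ¬ E u u
    hamiltonian : ∀ i j → CycleStep i j → E i j
    nonCrossing : ∀ u v x y → E u v → E x y → ¬ Cross u v x y
    maximal     : ∀ u v → u ≢ v → ¬ E u v → ∃[ x ] ∃[ y ] (E x y × Cross u v x y)

data Walk {n : ℕ} (E : Adj n) : Fin n → Fin n → ℕ → Set where
  nil  : ∀ {u} → Walk E u u 0
  cons : ∀ {u w v k} → E u w → Walk E w v k → Walk E u v (suc k)

DistLE : ∀ {n} → Adj n → Fin n → Fin n → ℕ → Set
DistLE E u v r = ∃[ k ] (k ≤ r × Walk E u v k)

Covers : ∀ {n} → Adj n → Fin n → Fin n → ℕ → Set
Covers E c₁ c₂ r = ∀ u → DistLE E u c₁ r ⊎ DistLE E u c₂ r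

OptimalTwoCenter : ∀ {n} → Adj n → Fin n → Fin n → ℕ → Set
OptimalTwoCenter E c₁ c₂ r =
  Covers E c₁ c₂ r × (∀ c₁' c₂' r' → Covers E c₁' c₂' r' → r ≤ r')

Continuous : ∀ {n} .{{nz : NonZero n}} → (Fin n → Bool) → Set
Continuous {n} S =
  Σ (Fin n) λ s → ∃[ ℓ ] (ℓ ≤ n × (∀ v → S v ≡ true → ∃[ t ] (t < ℓ × toℕ v ≡ (toℕ s + t) % n))
                     × (∀ v t → t < ℓ → toℕ v ≡ (toℕ s + t) % n → S v ≡ true))

compl : ∀ {n} → (Fin n → Bool) → Fin n → Bool
compl S v with S v
... | true  = false
... | false = true

{-# OPTIONS --safe #-}
module Submission where

-- Only the covering property of (c₁, c₂) is used, not the optimality of r.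
-- Record for every vertex whether it is known to lie within r of c₁ only, of c₂ only, or of both.
-- If "c₁ only" and "c₂ only" vertices alternate around the cycle as p, q, p′, q′, the walks
-- p → c₁ → p′ and q → c₂ → q′ join crossing chords, so in the outerplanar drawing they share a
-- vertex z. Then z lies on a walk of length ≤ r from p or p′ to c₁ and on one from q or q′ to c₂;
-- swapping their tails at z gives two walks of total length ≤ 2r, so one of them has length ≤ r,
-- and one more vertex becomes known near both centres. This happens only finitely often; once the
-- two classes no longer alternate, one of them lies in an arc avoiding the other, and that arc and
-- its complement are the cover sets.

open import Defs
open import Level using (0ℓ)
open import Function using (_∘_)
open import Data.Nat
  using (ℕ; NonZero; zero; suc; _+_; _∸_; _≤_; _<_; z≤n; z<s; s<s⁻¹; _≤?_; _<?_; _%_; >-nonZero⁻¹)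
open import Data.Nat.Properties hiding (_≟_)
open import Data.Nat.DivMod using (m<n⇒m%n≡m; [m+n]%n≡m%n; m%n<n; m%n%n≡m%n; %-distribˡ-+)
open import Data.Nat.Induction using (<-wellFounded)
open import Data.Nat.Solver using (module +-*-Solver)
open import Data.Fin using (Fin; toℕ; fromℕ<; _≟_) renaming (zero to fzero; suc to fsuc)
open import Data.Fin.Properties using (toℕ<n; toℕ-fromℕ<; toℕ-injective; any?)
open import Data.Bool using (Bool; true; false; not) renaming (_≟_ to _≟ᵇ_)
open import Data.Bool.Properties using (¬-not; not-involutive)
open import Data.Product using (∃₂; ∃-syntax; _×_; _,_)
open import Data.Sum using (_⊎_; inj₁; inj₂; [_,_])
import Data.Sum as Sum
open import Relation.Nullary using (¬_; Dec; yes; no; does; contradiction)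
open import Relation.Nullary.Decidable using (_×-dec_; dec-true; dec-false)
open import Relation.Binary.PropositionalEquality
  using (_≡_; _≢_; _≗_; refl; sym; trans; cong; subst; module ≡-Reasoning)
open import Relation.Binary.Definitions using (tri<; tri≈; tri>)
import Relation.Binary.Construct.On as On
import Induction.WellFounded as WF
open import Algebra.Properties.Monoid.Sum +-0-monoid using (sum)

dec-true⁻¹ : ∀ {A : Set} (a? : Dec A) → does a? ≡ true → A
dec-true⁻¹ (yes a) _ = a
dec-true⁻¹ (no _) ()

dec-false⁻¹ : ∀ {A : Set} (a? : Dec A) → does a? ≡ false → ¬ A
dec-false⁻¹ (no ¬a) _ = ¬a
dec-false⁻¹ (yes _) ()

sum-mono-≤ : ∀ {m} {f g : Fin m → ℕ} → (∀ v → f v ≤ g v) → sum f ≤ sum g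
sum-mono-≤ {zero}  _   = z≤n
sum-mono-≤ {suc m} f≤g = +-mono-≤ (f≤g fzero) (sum-mono-≤ (f≤g ∘ fsuc))

sum-mono-< : ∀ {m} {f g : Fin m → ℕ} → (∀ v → f v ≤ g v) → ∀ α → f α < g α → sum f < sum g
sum-mono-< f≤g fzero    fα<gα = +-mono-<-≤ fα<gα (sum-mono-≤ (f≤g ∘ fsuc))
sum-mono-< f≤g (fsuc α) fα<gα = +-mono-≤-< (f≤g fzero) (sum-mono-< (f≤g ∘ fsuc) α fα<gα)

¬range⇒below⊎beyond : ∀ {a b x} → ¬ (a ≤ x × x < b) → x < a ⊎ b ≤ x
¬range⇒below⊎beyond {a} {b} {x} ∉ with x <? a
... | yes x<a = inj₁ x<a
... | no  x≮a = inj₂ (≮⇒≥ λ x<b → ∉ (≮⇒≥ x≮a , x<b))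

[m%n+k]%n≡[m+k]%n : ∀ m k n .{{_ : NonZero n}} → (m % n + k) % n ≡ (m + k) % n
[m%n+k]%n≡[m+k]%n m k n = begin
  (m % n + k) % n         ≡⟨ %-distribˡ-+ (m % n) k n ⟩
  (m % n % n + k % n) % n ≡⟨ cong (λ x → (x + k % n) % n) (m%n%n≡m%n m n) ⟩
  (m % n + k % n) % n     ≡⟨ %-distribˡ-+ m k n ⟨
  (m + k) % n             ∎
  where open ≡-Reasoning

module _ {n : ℕ} {E : Adj n} where

  infixr 5 _++ʷ_
  infix  4 _∈ʷ_

  _++ʷ_ : ∀ {u v w k m} → Walk E u v k → Walk E v w m → Walk E u w (k + m)
  nil      ++ʷ q = q
  cons e p ++ʷ q = cons e (p ++ʷ q)

  snoc : ∀ {u v w k} → Walk E u v k → E v w → Walk E u w (suc k)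
  snoc nil         e = cons e nil
  snoc (cons e′ p) e = cons e′ (snoc p e)

  data _∈ʷ_ (z : Fin n) : ∀ {u v k} → Walk E u v k → Set where
    here  : ∀ {v k} {p : Walk E z v k} → z ∈ʷ p
    there : ∀ {u w v k} {e : E u w} {p : Walk E w v k} → z ∈ʷ p → z ∈ʷ cons e p

  ∈ʷ-end : ∀ {u v k} (p : Walk E u v k) → v ∈ʷ p
  ∈ʷ-end nil        = here
  ∈ʷ-end (cons e p) = there (∈ʷ-end p)

  ∈ʷ-++⁻ : ∀ {z u v w k m} (p : Walk E u v k) {q : Walk E v w m} → z ∈ʷ p ++ʷ q → z ∈ʷ p ⊎ z ∈ʷ q
  ∈ʷ-++⁻ nil        z∈q       = inj₂ z∈q
  ∈ʷ-++⁻ (cons e p) here      = inj₁ here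
  ∈ʷ-++⁻ (cons e p) (there h) = Sum.map₁ there (∈ʷ-++⁻ p h)

  ∈ʷ-split : ∀ {z u v k} {p : Walk E u v k} → z ∈ʷ p →
             ∃₂ λ i j → i + j ≡ k × Walk E u z i × Walk E z v j
  ∈ʷ-split {p = p} here = 0 , _ , refl , nil , p
  ∈ʷ-split (there {e = e} h) =
    let i , j , i+j≡k , pre , suf = ∈ʷ-split h in suc i , j , cong suc i+j≡k , cons e pre , suf

module _ {n : ℕ} {E : Adj n} (symmetric : ∀ u v → E u v → E v u) where

  reverse : ∀ {u v k} → Walk E u v k → Walk E v u k
  reverse nil        = nil
  reverse (cons e p) = snoc (reverse p) (symmetric _ _ e)

-- Crossing chords

module _ {n : ℕ} where

  between-or-outside : ∀ {u v x : Fin n} → x ≢ u → x ≢ v → Between u v x ⊎ Outside u v x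
  between-or-outside {u} {v} {x} x≢u x≢v with <-cmp (toℕ x) (toℕ u) | <-cmp (toℕ x) (toℕ v)
  ... | tri≈ _ x≡u _ | _            = contradiction (toℕ-injective x≡u) x≢u
  ... | _            | tri≈ _ x≡v _ = contradiction (toℕ-injective x≡v) x≢v
  ... | tri< x<u _ _ | tri< x<v _ _ = inj₂ (inj₁ (x<u , x<v))
  ... | tri< x<u _ _ | tri> _ _ v<x = inj₁ (inj₂ (v<x , x<u))
  ... | tri> _ _ u<x | tri< x<v _ _ = inj₁ (inj₁ (u<x , x<v))
  ... | tri> _ _ u<x | tri> _ _ v<x = inj₂ (inj₂ (u<x , v<x))

  between⇒¬outside : ∀ {u v x : Fin n} → Between u v x → ¬ Outside u v x
  between⇒¬outside (inj₁ (u<x , _))   (inj₁ (x<u , _)) = <-asym u<x x<u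
  between⇒¬outside (inj₁ (_ , x<v))   (inj₂ (_ , v<x)) = <-asym x<v v<x
  between⇒¬outside (inj₂ (v<x , _))   (inj₁ (_ , x<v)) = <-asym v<x x<v
  between⇒¬outside (inj₂ (_ , x<u))   (inj₂ (u<x , _)) = <-asym x<u u<x

  ¬Cross-degenerate : ∀ {u v x : Fin n} → ¬ Cross u v x x
  ¬Cross-degenerate (inj₁ (b , o)) = between⇒¬outside b o
  ¬Cross-degenerate (inj₂ (o , b)) = between⇒¬outside b o

  Cross-sym : ∀ {u v x y : Fin n} → Cross u v x y → Cross x y u v
  Cross-sym (inj₁ (inj₁ (u<x , x<v) , inj₁ (y<u , y<v))) = inj₁ (inj₂ (y<u , u<x) , inj₂ (x<v , y<v))
  Cross-sym (inj₁ (inj₁ (u<x , x<v) , inj₂ (u<y , v<y))) = inj₂ (inj₁ (u<x , u<y) , inj₁ (x<v , v<y))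
  Cross-sym (inj₁ (inj₂ (v<x , x<u) , inj₁ (y<u , y<v))) = inj₂ (inj₂ (x<u , y<u) , inj₂ (y<v , v<x))
  Cross-sym (inj₁ (inj₂ (v<x , x<u) , inj₂ (u<y , v<y))) = inj₁ (inj₁ (x<u , u<y) , inj₁ (v<x , v<y))
  Cross-sym (inj₂ (inj₁ (x<u , x<v) , inj₁ (u<y , y<v))) = inj₁ (inj₁ (x<u , u<y) , inj₂ (x<v , y<v))
  Cross-sym (inj₂ (inj₁ (x<u , x<v) , inj₂ (v<y , y<u))) = inj₂ (inj₂ (x<u , y<u) , inj₁ (x<v , v<y))
  Cross-sym (inj₂ (inj₂ (u<x , v<x) , inj₁ (u<y , y<v))) = inj₂ (inj₁ (u<x , u<y) , inj₂ (y<v , v<x))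
  Cross-sym (inj₂ (inj₂ (u<x , v<x) , inj₂ (v<y , y<u))) = inj₁ (inj₂ (y<u , u<x) , inj₁ (v<x , v<y))

  Cross-split : ∀ {u v x y z : Fin n} → Cross u v x y → z ≢ u → z ≢ v → Cross u v x z ⊎ Cross u v z y
  Cross-split cr z≢u z≢v with cr | between-or-outside z≢u z≢v
  ... | inj₁ (_  , oy) | inj₁ bz = inj₂ (inj₁ (bz , oy))
  ... | inj₁ (bx , _)  | inj₂ oz = inj₁ (inj₁ (bx , oz))
  ... | inj₂ (ox , _)  | inj₁ bz = inj₁ (inj₂ (ox , bz))
  ... | inj₂ (_  , by) | inj₂ oz = inj₂ (inj₂ (oz , by))

NonCrossing : ∀ {n} → Adj n → Set
NonCrossing E = ∀ u v x y → E u v → E x y → ¬ Cross u v x y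

module _ {n : ℕ} {E : Adj n} (nonCrossing : NonCrossing E) where

  walk-meets-crossing-edge : ∀ {u w x y m} → E u w → (q : Walk E x y m) → Cross u w x y → u ∈ʷ q ⊎ w ∈ʷ q
  walk-meets-crossing-edge e nil cr = contradiction cr ¬Cross-degenerate
  walk-meets-crossing-edge {u} {w} e (cons {w = x′} e′ q) cr with x′ ≟ u | x′ ≟ w
  ... | yes refl | _        = inj₁ (there here)
  ... | no _     | yes refl = inj₂ (there here)
  ... | no x′≢u  | no x′≢w  with Cross-split cr x′≢u x′≢w
  ...   | inj₁ cr₁ = contradiction cr₁ (nonCrossing _ _ _ _ e e′)
  ...   | inj₂ cr₂ = Sum.map there there (walk-meets-crossing-edge e q cr₂)

  crossing-walks-meet : ∀ {u v x y k m} (p : Walk E u v k) (q : Walk E x y m) → Cross u v x y →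
                        ∃[ z ] (z ∈ʷ p × z ∈ʷ q)
  crossing-walks-meet nil q cr = contradiction (Cross-sym cr) ¬Cross-degenerate
  crossing-walks-meet {x = x} {y} (cons {w = w} e p) q cr with w ≟ x | w ≟ y
  ... | yes refl | _        = w , there here , here
  ... | no _     | yes refl = w , there here , ∈ʷ-end q
  ... | no w≢x   | no w≢y   with Cross-split (Cross-sym cr) w≢x w≢y
  ...   | inj₁ cr₁ = [ (λ u∈q → _ , here , u∈q) , (λ w∈q → w , there here , w∈q) ]
                       (walk-meets-crossing-edge e q (Cross-sym cr₁))
  ...   | inj₂ cr₂ = let z , z∈p , z∈q = crossing-walks-meet p q (Cross-sym cr₂) in z , there z∈p , z∈q

module _ {n : ℕ} {E : Adj n} (symmetric : ∀ u v → E u v → E v u) (r : ℕ) where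

  DistLE-sym : ∀ {u v} → DistLE E u v r → DistLE E v u r
  DistLE-sym (k , k≤r , p) = k , k≤r , reverse symmetric p

  Through : Fin n → Fin n → Fin n → Set
  Through x y z = ∃₂ λ i j → i + j ≤ r × Walk E x z i × Walk E z y j

  Through-sym : ∀ {x y z} → Through x y z → Through y x z
  Through-sym (i , j , i+j≤r , p , q) =
    j , i , subst (_≤ r) (+-comm i j) i+j≤r , reverse symmetric q , reverse symmetric p

  ∈ʷ⇒Through : ∀ {x y z k} (p : Walk E x y k) → k ≤ r → z ∈ʷ p → Through x y z
  ∈ʷ⇒Through p k≤r z∈p =
    let i , j , i+j≡k , pre , suf = ∈ʷ-split z∈p in i , j , subst (_≤ r) (sym i+j≡k) k≤r , pre , suf

  ∈ʷ-++-reverse⇒Through : ∀ {x y c z kx ky} (p : Walk E x c kx) (q : Walk E y c ky) → kx ≤ r → ky ≤ r →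
                          z ∈ʷ p ++ʷ reverse symmetric q → Through x c z ⊎ Through y c z
  ∈ʷ-++-reverse⇒Through p q kx≤r ky≤r z∈pq =
    Sum.map (∈ʷ⇒Through p kx≤r) (Through-sym ∘ ∈ʷ⇒Through (reverse symmetric q) ky≤r) (∈ʷ-++⁻ p z∈pq)

  Through-exchange : ∀ {x y z c d} → Through x c z → Through y d z → DistLE E x d r ⊎ DistLE E y c r
  Through-exchange (i , j , i+j≤r , xz , zc) (i′ , j′ , i′+j′≤r , yz , zd) with i + j′ ≤? r
  ... | yes i+j′≤r = inj₁ (i + j′ , i+j′≤r , xz ++ʷ zd)
  ... | no  i+j′≰r = inj₂ (i′ + j , i′+j≤r , yz ++ʷ zc)
    where
    open +-*-Solver
    open ≤-Reasoning
    i′+j≤r : i′ + j ≤ r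
    i′+j≤r = <⇒≤ (+-cancelˡ-< r (i′ + j) r (begin-strict
      r + (i′ + j)        <⟨ +-monoˡ-< (i′ + j) (≰⇒> i+j′≰r) ⟩
      i + j′ + (i′ + j)   ≡⟨ solve 4 (λ i j i′ j′ → i :+ j′ :+ (i′ :+ j) := i :+ j :+ (i′ :+ j′)) refl i j i′ j′ ⟩
      i + j + (i′ + j′)   ≤⟨ +-mono-≤ i+j≤r i′+j′≤r ⟩
      r + r               ∎))

compl≗not : ∀ {m} (S : Fin m → Bool) → compl S ≗ not ∘ S
compl≗not S v with S v
... | true  = refl
... | false = refl

compl-true : ∀ {m} (S : Fin m → Bool) v → compl S v ≡ true → S v ≡ false
compl-true S v h with S v
compl-true S v () | true
compl-true S v _  | false = refl

compl-false : ∀ {m} (S : Fin m → Bool) v → compl S v ≡ false → S v ≡ true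
compl-false S v h with S v
compl-false S v _  | true  = refl
compl-false S v () | false

compl-involutive : ∀ {m} (S : Fin m → Bool) → compl (compl S) ≗ S
compl-involutive S v = trans (compl≗not (compl S) v) (trans (cong not (compl≗not S v)) (not-involutive (S v)))

module _ {n : ℕ} .{{_ : NonZero n}} where

  Continuous-cong : ∀ {S S′ : Fin n → Bool} → S ≗ S′ → Continuous S → Continuous S′
  Continuous-cong S≗S′ (s , ℓ , ℓ≤n , members , offsets) =
    s , ℓ , ℓ≤n , (λ v h → members v (trans (S≗S′ v) h)) ,
    (λ v t t<ℓ v≡ → trans (sym (S≗S′ v)) (offsets v t t<ℓ v≡))

  InInterval : Fin n → ℕ → Fin n → Set
  InInterval s ℓ v = toℕ s ≤ toℕ v × toℕ v < toℕ s + ℓ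

  InInterval? : ∀ s ℓ v → Dec (InInterval s ℓ v)
  InInterval? s ℓ v = toℕ s ≤? toℕ v ×-dec toℕ v <? toℕ s + ℓ

  interval : Fin n → ℕ → Fin n → Bool
  interval s ℓ v = does (InInterval? s ℓ v)

  b≡[a+[b∸a]]%n : ∀ {a b} → a ≤ b → b < n → b ≡ (a + (b ∸ a)) % n
  b≡[a+[b∸a]]%n a≤b b<n = sym (trans (cong (_% n) (m+[n∸m]≡n a≤b)) (m<n⇒m%n≡m b<n))

  interval-continuous : ∀ s ℓ → toℕ s + ℓ ≤ n → Continuous (interval s ℓ)
  interval-continuous s ℓ s+ℓ≤n = s , ℓ , ≤-trans (m≤n+m ℓ (toℕ s)) s+ℓ≤n , members , offsets
    where
    members : ∀ v → interval s ℓ v ≡ true → ∃[ t ] (t < ℓ × toℕ v ≡ (toℕ s + t) % n)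
    members v h =
      let s≤v , v<s+ℓ = dec-true⁻¹ (InInterval? s ℓ v) h in
      toℕ v ∸ toℕ s ,
      +-cancelˡ-< (toℕ s) _ _ (subst (_< toℕ s + ℓ) (sym (m+[n∸m]≡n s≤v)) v<s+ℓ) ,
      b≡[a+[b∸a]]%n s≤v (toℕ<n v)
    offsets : ∀ v t → t < ℓ → toℕ v ≡ (toℕ s + t) % n → interval s ℓ v ≡ true
    offsets v t t<ℓ v≡ = dec-true (InInterval? s ℓ v)
      (subst (λ x → toℕ s ≤ x × x < toℕ s + ℓ) (sym v≡s+t) (m≤m+n (toℕ s) t , s+t<s+ℓ))
      where
      s+t<s+ℓ : toℕ s + t < toℕ s + ℓ
      s+t<s+ℓ = +-monoʳ-< (toℕ s) t<ℓ
      v≡s+t : toℕ v ≡ toℕ s + t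
      v≡s+t = trans v≡ (m<n⇒m%n≡m (<-≤-trans s+t<s+ℓ s+ℓ≤n))

  below⊎beyond⇒arc-offset : ∀ {a b x} → b ≤ n → x < n → x < a ⊎ b ≤ x →
                  ∃[ t ] (t < (n ∸ b) + a × x ≡ (b + t) % n)
  below⊎beyond⇒arc-offset {a} {b} {x} b≤n x<n (inj₁ x<a) = (n ∸ b) + x , +-monoʳ-< (n ∸ b) x<a , sym (begin
    (b + ((n ∸ b) + x)) % n ≡⟨ cong (_% n) (+-assoc b (n ∸ b) x) ⟨
    (b + (n ∸ b) + x) % n   ≡⟨ cong (λ y → (y + x) % n) (m+[n∸m]≡n b≤n) ⟩
    (n + x) % n             ≡⟨ cong (_% n) (+-comm n x) ⟩
    (x + n) % n             ≡⟨ [m+n]%n≡m%n x n ⟩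
    x % n                   ≡⟨ m<n⇒m%n≡m x<n ⟩
    x                       ∎)
    where open ≡-Reasoning
  below⊎beyond⇒arc-offset {a} {b} {x} _ x<n (inj₂ b≤x) =
    x ∸ b , <-≤-trans (∸-monoˡ-< x<n b≤x) (m≤m+n (n ∸ b) a) , b≡[a+[b∸a]]%n b≤x x<n

  arc-offset⇒¬range : ∀ {a b x t} → b ≤ n → a < n → t < (n ∸ b) + a → x ≡ (b + t) % n → ¬ (a ≤ x × x < b)
  arc-offset⇒¬range {a} {b} {x} {t} b≤n a<n t<ℓ x≡ (a≤x , x<b) with b + t <? n
  ... | yes b+t<n = <⇒≱ x<b (subst (b ≤_) (sym (trans x≡ (m<n⇒m%n≡m b+t<n))) (m≤m+n b t))
  ... | no  b+t≮n = <⇒≱ (subst (_< a) (sym x≡b+t∸n) b+t∸n<a) a≤x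
    where
    n≤b+t : n ≤ b + t
    n≤b+t = ≮⇒≥ b+t≮n
    b+t<n+a : b + t < n + a
    b+t<n+a = subst (b + t <_) (trans (sym (+-assoc b (n ∸ b) a)) (cong (_+ a) (m+[n∸m]≡n b≤n)))
                    (+-monoʳ-< b t<ℓ)
    b+t∸n<a : b + t ∸ n < a
    b+t∸n<a = subst (b + t ∸ n <_) (m+n∸m≡n n a) (∸-monoˡ-< b+t<n+a n≤b+t)
    x≡b+t∸n : x ≡ b + t ∸ n
    x≡b+t∸n = begin
      x                   ≡⟨ x≡ ⟩
      (b + t) % n         ≡⟨ cong (_% n) (m∸n+n≡m n≤b+t) ⟨
      (b + t ∸ n + n) % n ≡⟨ [m+n]%n≡m%n (b + t ∸ n) n ⟩
      (b + t ∸ n) % n     ≡⟨ m<n⇒m%n≡m (<-trans b+t∸n<a a<n) ⟩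
      b + t ∸ n           ∎
      where open ≡-Reasoning

  -- The complement of [a, b) is the arc of length (n ∸ b) + a starting at b, read modulo n.
  interval-compl-continuous : ∀ s ℓ → toℕ s + ℓ ≤ n → Continuous (compl (interval s ℓ))
  interval-compl-continuous s ℓ b≤n = start , (n ∸ b) + a , ℓ′≤n , members , offsets
    where
    a b : ℕ
    a = toℕ s
    b = a + ℓ
    start : Fin n
    start = fromℕ< (m%n<n b n)
    start+t : ∀ t → (toℕ start + t) % n ≡ (b + t) % n
    start+t t = trans (cong (λ x → (x + t) % n) (toℕ-fromℕ< (m%n<n b n))) ([m%n+k]%n≡[m+k]%n b t n)
    ℓ′≤n : (n ∸ b) + a ≤ n
    ℓ′≤n = ≤-trans (+-monoʳ-≤ (n ∸ b) (m≤m+n a ℓ)) (≤-reflexive (trans (+-comm (n ∸ b) b) (m+[n∸m]≡n b≤n)))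
    members : ∀ v → compl (interval s ℓ) v ≡ true → ∃[ t ] (t < (n ∸ b) + a × toℕ v ≡ (toℕ start + t) % n)
    members v h =
      let ∉ = dec-false⁻¹ (InInterval? s ℓ v) (compl-true (interval s ℓ) v h)
          t , t<ℓ′ , v≡ = below⊎beyond⇒arc-offset b≤n (toℕ<n v) (¬range⇒below⊎beyond ∉)
      in t , t<ℓ′ , trans v≡ (sym (start+t t))
    offsets : ∀ v t → t < (n ∸ b) + a → toℕ v ≡ (toℕ start + t) % n → compl (interval s ℓ) v ≡ true
    offsets v t t<ℓ′ v≡ = trans (compl≗not (interval s ℓ) v)
      (cong not (dec-false (InInterval? s ℓ v) (arc-offset⇒¬range b≤n (toℕ<n s) t<ℓ′ (trans v≡ (start+t t)))))

-- Separating two sets of positions by an arc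

least : ∀ {m} (P : Fin m → Bool) →
        (∃[ i ] (P i ≡ true × ∀ v → toℕ v < toℕ i → P v ≡ false)) ⊎ (∀ v → P v ≡ false)
least {zero}  P = inj₂ λ ()
least {suc m} P with P fzero in P0 | least (P ∘ fsuc)
... | true  | _                       = inj₁ (fzero , P0 , λ _ ())
... | false | inj₁ (i , Pi , below-i) =
  inj₁ (fsuc i , Pi , λ { fzero _ → P0 ; (fsuc v) v<i → below-i v (s<s⁻¹ v<i) })
... | false | inj₂ none               = inj₂ λ { fzero → P0 ; (fsuc v) → none v }

greatest : ∀ {m} (P : Fin m → Bool) →
           (∃[ i ] (P i ≡ true × ∀ v → toℕ i < toℕ v → P v ≡ false)) ⊎ (∀ v → P v ≡ false)
greatest {zero}  P = inj₂ λ ()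
greatest {suc m} P with greatest (P ∘ fsuc) | P fzero in P0
... | inj₁ (i , Pi , above-i) | _     =
  inj₁ (fsuc i , Pi , λ { fzero () ; (fsuc v) i<v → above-i v (s<s⁻¹ i<v) })
... | inj₂ none               | true  = inj₁ (fzero , P0 , λ { fzero () ; (fsuc v) _ → none v })
... | inj₂ none               | false = inj₂ λ { fzero → P0 ; (fsuc v) → none v }

record Hull {m} (P : Fin m → Bool) : Set where
  field
    lo hi    : Fin m
    lo-in    : P lo ≡ true
    hi-in    : P hi ≡ true
    below-lo : ∀ v → toℕ v < toℕ lo → P v ≡ false
    above-hi : ∀ v → toℕ hi < toℕ v → P v ≡ false

  lo≤hi : toℕ lo ≤ toℕ hi
  lo≤hi = ≮⇒≥ λ hi<lo → contradiction (trans (sym hi-in) (below-lo hi hi<lo)) λ ()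

hull : ∀ {m} (P : Fin m → Bool) → Hull P ⊎ (∀ v → P v ≡ false)
hull P with least P | greatest P
... | inj₂ none                | _                        = inj₂ none
... | inj₁ (lo , lo-in , _)    | inj₂ none                = contradiction (trans (sym lo-in) (none lo)) λ ()
... | inj₁ (lo , lo-in , below) | inj₁ (hi , hi-in , above) = inj₁ (record
  { lo = lo ; hi = hi ; lo-in = lo-in ; hi-in = hi-in ; below-lo = below ; above-hi = above })

search-between : ∀ {m} (P : Fin m → Bool) (a b : Fin m) →
                 (∃[ v ] (toℕ a < toℕ v × toℕ v < toℕ b × P v ≡ true)) ⊎
                 (∀ v → toℕ a < toℕ v → toℕ v < toℕ b → P v ≡ false)
search-between P a b with any? (λ v → toℕ a <? toℕ v ×-dec toℕ v <? toℕ b ×-dec P v ≟ᵇ true)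
... | yes found = inj₁ found
... | no  none  = inj₂ λ v a<v v<b → ¬-not λ Pv → none (v , a<v , v<b , Pv)

module _ {n : ℕ} .{{_ : NonZero n}} where

  Disjoint : (P Q : Fin n → Bool) → Set
  Disjoint P Q = ∀ v → P v ≡ true → Q v ≡ false

  Separated : (P Q : Fin n → Bool) → Set
  Separated P Q = ∃[ S ] ((∀ v → S v ≡ true → Q v ≡ false) × (∀ v → S v ≡ false → P v ≡ false)
                          × Continuous S × Continuous (compl S))

  Interleaved : (P Q : Fin n → Bool) → Set
  Interleaved P Q = ∃[ a ] ∃[ b ] ∃[ c ] ∃[ d ]
    (P a ≡ true × Q b ≡ true × P c ≡ true × Q d ≡ true × Cross a c b d)

  Disjoint-sym : ∀ {P Q} → Disjoint P Q → Disjoint Q P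
  Disjoint-sym {P} disj v Qv with P v in Pv
  ... | true  = contradiction (trans (sym Qv) (disj v Pv)) λ ()
  ... | false = refl

  Separated-swap : ∀ {P Q} → Separated Q P → Separated P Q
  Separated-swap (S , S-true , S-false , S-cont , Sᶜ-cont) =
    compl S , (λ v h → S-false v (compl-true S v h)) , (λ v h → S-true v (compl-false S v h)) ,
    Sᶜ-cont , Continuous-cong (λ v → sym (compl-involutive S v)) S-cont

  Interleaved-swap : ∀ {P Q} → Interleaved Q P → Interleaved P Q
  Interleaved-swap (a , b , c , d , Qa , Pb , Qc , Pd , cr) = b , a , d , c , Pb , Qa , Pd , Qc , Cross-sym cr

  interval-separated : ∀ {P Q} s ℓ → toℕ s + ℓ ≤ n →
                       (∀ v → InInterval s ℓ v → Q v ≡ false) → (∀ v → ¬ InInterval s ℓ v → P v ≡ false) →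
                       Separated P Q
  interval-separated s ℓ s+ℓ≤n inside outside =
    interval s ℓ ,
    (λ v h → inside v (dec-true⁻¹ (InInterval? s ℓ v) h)) ,
    (λ v h → outside v (dec-false⁻¹ (InInterval? s ℓ v) h)) ,
    interval-continuous s ℓ s+ℓ≤n , interval-compl-continuous s ℓ s+ℓ≤n

  empty-separated : ∀ {P Q} → (∀ v → P v ≡ false) → Separated P Q
  empty-separated none = interval-separated s 0 s+0≤n
    (λ v (s≤v , v<s+0) → contradiction s≤v (<⇒≱ (subst (toℕ v <_) (+-identityʳ (toℕ s)) v<s+0)))
    (λ v _ → none v)
    where
    s : Fin n
    s = fromℕ< (>-nonZero⁻¹ n)
    s+0≤n : toℕ s + 0 ≤ n
    s+0≤n = subst (_≤ n) (sym (+-identityʳ (toℕ s))) (<⇒≤ (toℕ<n s))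

  hull-separated : ∀ {P Q} → Disjoint P Q → (h : Hull P) →
                   (∀ v → toℕ (Hull.lo h) < toℕ v → toℕ v < toℕ (Hull.hi h) → Q v ≡ false) → Separated P Q
  hull-separated {P} {Q} disj h clear = interval-separated lo width bound inside outside
    where
    open Hull h
    width : ℕ
    width = suc (toℕ hi) ∸ toℕ lo
    lo+width≡ : toℕ lo + width ≡ suc (toℕ hi)
    lo+width≡ = m+[n∸m]≡n (m≤n⇒m≤1+n lo≤hi)
    bound : toℕ lo + width ≤ n
    bound = subst (_≤ n) (sym lo+width≡) (toℕ<n hi)
    inside : ∀ v → InInterval lo width v → Q v ≡ false
    inside v (lo≤v , v<end) with m≤n⇒m<n∨m≡n lo≤v | m<1+n⇒m<n∨m≡n (subst (toℕ v <_) lo+width≡ v<end)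
    ... | inj₂ lo≡v | _         = disj v (subst (λ x → P x ≡ true) (toℕ-injective lo≡v) lo-in)
    ... | inj₁ _    | inj₂ v≡hi = disj v (subst (λ x → P x ≡ true) (sym (toℕ-injective v≡hi)) hi-in)
    ... | inj₁ lo<v | inj₁ v<hi = clear v lo<v v<hi
    outside : ∀ v → ¬ InInterval lo width v → P v ≡ false
    outside v ∉ with ¬range⇒below⊎beyond ∉
    ... | inj₁ v<lo  = below-lo v v<lo
    ... | inj₂ end≤v = above-hi v (subst (_≤ toℕ v) lo+width≡ end≤v)

  interleaved-or-separated : ∀ {P Q} → Disjoint P Q → (hP : Hull P) (hQ : Hull Q) →
                             toℕ (Hull.lo hP) < toℕ (Hull.lo hQ) → Interleaved P Q ⊎ Separated Q P
  interleaved-or-separated {P} disj hP hQ loP<loQ with search-between P (Hull.lo hQ) (Hull.hi hQ)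
  ... | inj₁ (x , loQ<x , x<hiQ , Px) =
    inj₁ (Hull.lo hP , Hull.lo hQ , x , Hull.hi hQ , Hull.lo-in hP , Hull.lo-in hQ , Px , Hull.hi-in hQ ,
          inj₁ (inj₁ (loP<loQ , loQ<x) , inj₂ (<-trans loP<loQ (<-trans loQ<x x<hiQ) , x<hiQ)))
  ... | inj₂ clear = inj₂ (hull-separated (Disjoint-sym disj) hQ clear)

  separated-or-interleaved : (P Q : Fin n → Bool) → Disjoint P Q → Separated P Q ⊎ Interleaved P Q
  separated-or-interleaved P Q disj with hull P | hull Q
  ... | inj₂ noP | _        = inj₁ (empty-separated noP)
  ... | inj₁ _   | inj₂ noQ = inj₁ (Separated-swap (empty-separated noQ))
  ... | inj₁ hP  | inj₁ hQ  with <-cmp (toℕ (Hull.lo hP)) (toℕ (Hull.lo hQ))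
  ...   | tri< loP<loQ _ _ = Sum.swap (Sum.map₂ Separated-swap (interleaved-or-separated disj hP hQ loP<loQ))
  ...   | tri> _ _ loQ<loP = Sum.swap (Sum.map₁ Interleaved-swap
                               (interleaved-or-separated (Disjoint-sym disj) hQ hP loQ<loP))
  ...   | tri≈ _ lo≡lo _   = contradiction
          (trans (sym (Hull.lo-in hQ)) (subst (λ x → Q x ≡ false) (toℕ-injective lo≡lo) (disj _ (Hull.lo-in hP))))
          λ ()

-- Refining a two-centre cover

module CoverRefinement {n : ℕ} .{{_ : NonZero n}} {E : Adj n} (G : MaximalOuterplanarLabelled E)
                       (c₁ c₂ : Fin n) (r : ℕ) where

  open MaximalOuterplanarLabelled G using (symmetric; nonCrossing)

  CoverSets : Set
  CoverSets = ∃[ S₁ ] ((∀ v → S₁ v ≡ true → DistLE E c₁ v r)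
                       × (∀ v → S₁ v ≡ false → DistLE E c₂ v r)
                       × Continuous S₁ × Continuous (compl S₁))

  crossing-cover-exchange : ∀ {p p′ q q′} → Cross p p′ q q′ →
    DistLE E p c₁ r → DistLE E p′ c₁ r → DistLE E q c₂ r → DistLE E q′ c₂ r →
    (DistLE E p c₂ r ⊎ DistLE E p′ c₂ r) ⊎ (DistLE E q c₁ r ⊎ DistLE E q′ c₁ r)
  crossing-cover-exchange cr (_ , kp≤r , wp) (_ , kp′≤r , wp′) (_ , kq≤r , wq) (_ , kq′≤r , wq′)
    with crossing-walks-meet nonCrossing (wp ++ʷ reverse symmetric wp′) (wq ++ʷ reverse symmetric wq′) cr
  ... | z , z∈pp′ , z∈qq′
    with ∈ʷ-++-reverse⇒Through symmetric r wp wp′ kp≤r kp′≤r z∈pp′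
       | ∈ʷ-++-reverse⇒Through symmetric r wq wq′ kq≤r kq′≤r z∈qq′
  ... | inj₁ tp  | inj₁ tq  = Sum.map inj₁ inj₁ (Through-exchange symmetric r tp tq)
  ... | inj₁ tp  | inj₂ tq′ = Sum.map inj₁ inj₂ (Through-exchange symmetric r tp tq′)
  ... | inj₂ tp′ | inj₁ tq  = Sum.map inj₂ inj₁ (Through-exchange symmetric r tp′ tq)
  ... | inj₂ tp′ | inj₂ tq′ = Sum.map inj₂ inj₂ (Through-exchange symmetric r tp′ tq′)

  -- DistLE is undecidable (E is an arbitrary relation), so instead of computing distances we
  -- refine what has been established about each vertex.
  data Status (v : Fin n) : Set where
    near₁     : DistLE E v c₁ r → Status v
    near₂     : DistLE E v c₂ r → Status v
    near-both : DistLE E v c₁ r → DistLE E v c₂ r → Status v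

  only₁ only₂ : ∀ {v} → Status v → Bool
  only₁ (near₁ _) = true
  only₁ _         = false
  only₂ (near₂ _) = true
  only₂ _         = false

  pending : ∀ {v} → Status v → ℕ
  pending (near-both _ _) = 0
  pending _               = 1

  near₁-unless-only₂ : ∀ {v} (s : Status v) → only₂ s ≡ false → DistLE E v c₁ r
  near₁-unless-only₂ (near₁ x₁)       _  = x₁
  near₁-unless-only₂ (near-both x₁ _) _  = x₁
  near₁-unless-only₂ (near₂ _)        ()

  near₂-unless-only₁ : ∀ {v} (s : Status v) → only₁ s ≡ false → DistLE E v c₂ r
  near₂-unless-only₁ (near₂ x₂)       _  = x₂
  near₂-unless-only₁ (near-both _ x₂) _  = x₂
  near₂-unless-only₁ (near₁ _)        ()

  only₁⇒near₁∧pending : ∀ {v} (s : Status v) → only₁ s ≡ true → DistLE E v c₁ r × 0 < pending s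
  only₁⇒near₁∧pending (near₁ x₁) _ = x₁ , z<s

  only₂⇒near₂∧pending : ∀ {v} (s : Status v) → only₂ s ≡ true → DistLE E v c₂ r × 0 < pending s
  only₂⇒near₂∧pending (near₂ x₂) _ = x₂ , z<s

  State : Set
  State = (v : Fin n) → Status v

  Only₁ Only₂ : State → Fin n → Bool
  Only₁ st v = only₁ (st v)
  Only₂ st v = only₂ (st v)

  Only-disjoint : ∀ st → Disjoint (Only₁ st) (Only₂ st)
  Only-disjoint st v h with st v
  Only-disjoint st v _  | near₁ _       = refl
  Only-disjoint st v () | near₂ _
  Only-disjoint st v () | near-both _ _

  undecided : State → ℕ
  undecided st = sum (pending ∘ st)

  settle : State → (α : Fin n) → DistLE E α c₁ r → DistLE E α c₂ r → State
  settle st α x₁ x₂ v with v ≟ α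
  ... | yes refl = near-both x₁ x₂
  ... | no  _    = st v

  settle-decreases : ∀ st α x₁ x₂ → 0 < pending (st α) → undecided (settle st α x₁ x₂) < undecided st
  settle-decreases st α x₁ x₂ 0<pα = sum-mono-< settled-≤ α settled-<
    where
    settled-≤ : ∀ v → pending (settle st α x₁ x₂ v) ≤ pending (st v)
    settled-≤ v with v ≟ α
    ... | yes refl = z≤n
    ... | no  _    = ≤-refl
    settled-< : pending (settle st α x₁ x₂ α) < pending (st α)
    settled-< with α ≟ α
    ... | yes refl = 0<pα
    ... | no  α≢α  = contradiction refl α≢α

  pending-near-both : ∀ st → Interleaved (Only₁ st) (Only₂ st) →
                      ∃[ v ] (0 < pending (st v) × DistLE E v c₁ r × DistLE E v c₂ r)
  pending-near-both st (p , q , p′ , q′ , Pp , Qq , Pp′ , Qq′ , cr)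
    with only₁⇒near₁∧pending (st p) Pp | only₁⇒near₁∧pending (st p′) Pp′
       | only₂⇒near₂∧pending (st q) Qq | only₂⇒near₂∧pending (st q′) Qq′
  ... | p₁ , p-pending | p′₁ , p′-pending | q₂ , q-pending | q′₂ , q′-pending
    with crossing-cover-exchange cr p₁ p′₁ q₂ q′₂
  ... | inj₁ (inj₁ p₂)  = p  , p-pending  , p₁  , p₂
  ... | inj₁ (inj₂ p′₂) = p′ , p′-pending , p′₁ , p′₂
  ... | inj₂ (inj₁ q₁)  = q  , q-pending  , q₁  , q₂
  ... | inj₂ (inj₂ q′₁) = q′ , q′-pending , q′₁ , q′₂

  cover-sets : ∀ st → Separated (Only₁ st) (Only₂ st) → CoverSets
  cover-sets st (S , S-true , S-false , S-cont , Sᶜ-cont) =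
    S , (λ v h → DistLE-sym symmetric r (near₁-unless-only₂ (st v) (S-true v h))) ,
        (λ v h → DistLE-sym symmetric r (near₂-unless-only₁ (st v) (S-false v h))) , S-cont , Sᶜ-cont

  refine : State → CoverSets
  refine = WF.All.wfRec (On.wellFounded undecided <-wellFounded) 0ℓ (λ _ → CoverSets) step
    where
    step : ∀ st → (∀ {st′} → undecided st′ < undecided st → CoverSets) → CoverSets
    step st rec with separated-or-interleaved (Only₁ st) (Only₂ st) (Only-disjoint st)
    ... | inj₁ separation  = cover-sets st separation
    ... | inj₂ alternation with pending-near-both st alternation
    ...   | α , 0<pα , x₁ , x₂ = rec (settle-decreases st α x₁ x₂ 0<pα)

  initial : Covers E c₁ c₂ r → State
  initial cov v = [ near₁ , near₂ ] (cov v)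

lemma1 : (n : ℕ) .{{_ : NonZero n}} (E : Adj n) → MaximalOuterplanarLabelled E →
         (c₁ c₂ : Fin n) (r : ℕ) → OptimalTwoCenter E c₁ c₂ r →
         ∃[ S₁ ] ((∀ v → S₁ v ≡ true → DistLE E c₁ v r)
                  × (∀ v → S₁ v ≡ false → DistLE E c₂ v r)
                  × Continuous S₁ × Continuous (compl S₁))
lemma1 n E G c₁ c₂ r (covers , _) = refine (initial covers)
  where open CoverRefinement G c₁ c₂ r
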